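{- Let $p\geq 5$ be a prime and $n$ a positive integer, and let $X_1,\dots,X_p\subseteq\mathbb{F}_p^{n}$ be such that every cycle $(x_1,\dots,x_p)\in X_1\times\dots\times X_p$ satisfies $x_1=x_2$. Let $\mathcal{M}\subseteq X_1\times\dots\times X_p$ be a collection of $L\geq 1$ pairwise disjoint cycles. Then there exists a subcollection $\mathcal{M}'\subseteq \mathcal{M}$ of size $\vert \mathcal{M}'\vert\geq L^2/(2p^{n+1})$ such that for any two distinct cycles $(x_1,\dots,x_p), (x_1',\dots,x_p')\in \mathcal{M}'$ and any $j\in \{3,\dots,p\}$, the pair $(x_1,x_j')$ is not $j$-extendable.
   Context: A cycle is a $p$-tuple $(x_1,\dots,x_p)\in (\mathbb{F}_p^{n})^p$ with $x_1+\dots+x_p=0$. Two cycles $(x_1,\dots,x_p)$ and $(x_1',\dots,x_p')$ are disjoint if the sets $\{x_1,\dots,x_p\}$ and $\{x_1',\dots,x_p'\}$ are disjoint. For $j\in\{3,\dots,p\}$, a pair $(y,z)\in X_1\times X_j$ is called $j$-extendable if there exists a cycle $(x_1,\dots,x_p)\in X_1\times\dots\times X_p$ with $x_1=y$ and $x_j=z$. -}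

module Defs where

open import Data.Nat using (ℕ; _%_; _≤_; _*_; _^_; NonZero)
open import Data.Fin using (Fin; toℕ)
open import Data.Vec using (Vec; lookup)
open import Data.List using (List; map; allFin)
open import Data.Nat.ListAction using (sum)
open import Data.Product using (Σ; _×_; ∃)
open import Relation.Binary.PropositionalEquality using (_≡_; _≢_)
open import Level using (0ℓ)
open import Relation.Unary using (Pred)

Point : ℕ → ℕ → Set
Point p n = Vec (Fin p) n

-- A p-tuple of points, indexed by Fin p (index i corresponds to x_{i+1}).
Tuple : ℕ → ℕ → Set
Tuple p n = Fin p → Point p n

IsCycle : (p n : ℕ) → .{{NonZero p}} → Tuple p n → Set
IsCycle p n x = (k : Fin n) → sum (map (λ i → toℕ (lookup (x i) k)) (allFin p)) % p ≡ 0

InProd : {p n : ℕ} → (Fin p → Pred (Point p n) 0ℓ) → Tuple p n → Set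
InProd {p} X x = (i : Fin p) → X i (x i)

Disjoint : {p n : ℕ} → Tuple p n → Tuple p n → Set
Disjoint {p} x x' = (a b : Fin p) → x a ≢ x' b

-- (y , z) ∈ X_1 × X_j is j-extendable (j given 0-based as an element of Fin p).
Extendable : (p n : ℕ) → .{{NonZero p}} → (Fin p → Pred (Point p n) 0ℓ) →
             Fin p → Point p n → Point p n → Set
Extendable p n X j y z =
  Σ (Tuple p n) λ x → InProd X x × IsCycle p n x ×
    ((i : Fin p) → toℕ i ≡ 0 → x i ≡ y) × (x j ≡ z)

-- Call (a, b) j-unshared if the point x^a_1 + x^b_j of F_p^n is not also x^d_1 + x^e_j for a
-- cycle d ≠ a.  If it is shared, (x^a_1, x^b_j) is not j-extendable: in an extending cycle,
-- whose first two entries both equal x^a_1, replace x_2 and x_j by x^d_2 = x^d_1 and x^e_j.  The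
-- sum does not change, so this is again a cycle in X_1 × ⋯ × X_p and its first two entries agree,
-- giving x^a_1 = x^d_1 against disjointness.  An unshared pair is determined by its point, so for
-- each j ≥ 3 there are at most p^n of them.  Join a and b when (a, b) or (b, a) is j-unshared for
-- some j ≥ 3: the degree sum is at most 2(p − 2)p^n and L ≤ p^n, so Turán's bound
-- |I| ≥ L² / (L + degree sum) gives an independent set I with |I| ≥ L² / (2p^(n+1)), and any two
-- cycles of I form only shared pairs.

module Submission where

open import Defs
open import Data.Nat using (ℕ; _≤_; _*_; _^_; suc; NonZero)
open import Data.Nat.Primality using (Prime)
open import Data.Fin using (Fin; toℕ)
open import Data.List using (List; length)
open import Data.List.Membership.Propositional using (_∈_)
open import Data.List.Relation.Unary.Unique.Propositional using (Unique)
open import Data.Product using (Σ; _×_)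
open import Relation.Binary.PropositionalEquality using (_≡_; _≢_)
open import Relation.Nullary using (¬_)
open import Relation.Unary using (Pred)
open import Level using (0ℓ)

open import Data.Nat using (zero; _+_; _∸_; _<_; z≤n; s≤s; _≤?_)
open import Data.Nat.Properties
open import Data.Nat.DivMod using (_%_; _/_; _mod_; %-distribˡ-+; [m+kn]%n≡m%n; m≡m%n+[m/n]*n; m%n≤n; m<n⇒m%n≡m)
open import Data.Nat.ListAction using (sum)
open import Data.Nat.Tactic.RingSolver using (solve-∀)
open import Data.Fin using (zero; suc; funToFin; finToFun)
import Data.Fin as Fin
import Data.Fin.Properties as Fin
open import Data.Fin.Properties using (injective⇒≤; toℕ-fromℕ<; toℕ-injective; toℕ<n; finToFun-funToFin)
open import Data.Vec using (Vec; lookup; zipWith)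
open import Data.Vec.Properties using (≡-dec; lookup-zipWith; tabulate∘lookup; tabulate-cong)
open import Data.Vec.Functional using (updateAt)
open import Data.Vec.Functional.Properties using (updateAt-updates; updateAt-minimal)
open import Data.List using ([]; _∷_; _++_; map; filter; allFin; cartesianProduct)
import Data.List as List
open import Data.List.Properties using (length-tabulate; filter-++; length-++; filter-none; filter-some)
open import Data.List.Membership.Propositional using (lose)
open import Data.List.Membership.Propositional.Properties using (∈-filter⁻; ∈-allFin; ∈-lookup)
open import Data.List.Relation.Unary.Any using (Any; here; there; any?; toSum)
open import Data.List.Relation.Unary.All as All using (All; []; _∷_)
open import Data.List.Relation.Unary.All.Properties using (all-filter)
open import Data.List.Relation.Unary.AllPairs using ([]; _∷_)
import Data.List.Relation.Unary.Unique.Propositional.Properties as Unique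
import Data.List.Relation.Binary.Sublist.Propositional as Sublist
import Data.List.Relation.Binary.Sublist.Propositional.Properties as Sublist
open import Data.List.Extrema.Nat using (argmin; argmin-sel; f[argmin]≤f[⊤]; f[argmin]≤f[xs])
open import Data.Bool using (true; false)
open import Data.Product using (∃₂; _,_; proj₁; proj₂; uncurry; swap)
open import Data.Sum using (_⊎_; inj₁; inj₂; [_,_]′)
import Data.Sum as Sum
open import Function using (_∘_; const; id)
open import Relation.Binary using (Rel; REL; Symmetric; DecidableEquality)
import Relation.Binary as Binary
open import Relation.Binary.PropositionalEquality using (refl; sym; trans; cong; cong₂; subst; module ≡-Reasoning)
open import Relation.Nullary using (yes; no; does; contradiction; ¬?)
open import Relation.Nullary.Decidable using (_⊎-dec_; _×-dec_; decidable-stable)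
open import Relation.Unary using (Decidable; _∪_; _⊆_)
open import Relation.Unary.Properties using (∁?; _∪?_)

private variable
  A B : Set

m*m≤n*n⇒m≤n : ∀ m n → m * m ≤ n * n → m ≤ n
m*m≤n*n⇒m≤n m n m²≤n² with m ≤? n
... | yes m≤n = m≤n
... | no m≰n = contradiction m²≤n² (<⇒≱ (*-mono-< n<m n<m))
  where n<m = ≰⇒> m≰n

4*m*n≤[m+n]*[m+n] : ∀ m n → 4 * m * n ≤ (m + n) * (m + n)
4*m*n≤[m+n]*[m+n] m n with ≤-total m n
... | inj₁ m≤n = subst (λ n → 4 * m * n ≤ (m + n) * (m + n)) (m+[n∸m]≡n m≤n)
                   (≤-trans (m≤m+n _ (t * t)) (≤-reflexive (square m t)))
  where
  t = n ∸ m
  square : ∀ m t → 4 * m * (m + t) + t * t ≡ (m + (m + t)) * (m + (m + t))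
  square = solve-∀
... | inj₂ n≤m = subst (λ m → 4 * m * n ≤ (m + n) * (m + n)) (m+[n∸m]≡n n≤m)
                   (≤-trans (m≤m+n _ (t * t)) (≤-reflexive (square n t)))
  where
  t = m ∸ n
  square : ∀ n t → 4 * (n + t) * n + t * t ≡ (n + t + n) * (n + t + n)
  square = solve-∀

c*c≤x*y⇒2*c≤x+y : ∀ c x y → c * c ≤ x * y → 2 * c ≤ x + y
c*c≤x*y⇒2*c≤x+y c x y c²≤xy = m*m≤n*n⇒m≤n (2 * c) (x + y) (begin
  2 * c * (2 * c) ≡⟨ four-squares c ⟩
  4 * (c * c)     ≤⟨ *-monoʳ-≤ 4 c²≤xy ⟩
  4 * (x * y)     ≡⟨ sym (*-assoc 4 x y) ⟩
  4 * x * y       ≤⟨ 4*m*n≤[m+n]*[m+n] x y ⟩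
  (x + y) * (x + y) ∎)
  where
  open ≤-Reasoning
  four-squares : ∀ c → 2 * c * (2 * c) ≡ 4 * (c * c)
  four-squares = solve-∀

-- The induction step of Turán's bound: deleting m vertices that carry at least m² − m
-- of the degree sum e and adding one vertex to the independent set.
turán-step : ∀ m n k e e′ → n * n ≤ k * (n + e′) → e′ + m * m ≤ e + m →
              (m + n) * (m + n) ≤ suc k * (m + n + e)
turán-step m n k e e′ n²≤ e′≤ = begin
  (m + n) * (m + n)                                ≡⟨ expand m n ⟩
  n * n + 2 * (m * n) + m * m                      ≤⟨ +-monoˡ-≤ (m * m) (+-mono-≤ n²≤ cross) ⟩
  k * (n + e′) + (k * (m * m) + (n + e′)) + m * m ≡⟨ collect m n k e′ ⟩
  suc k * (n + (e′ + m * m))                       ≤⟨ *-monoʳ-≤ (suc k) (+-monoʳ-≤ n e′≤) ⟩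
  suc k * (n + (e + m))                            ≡⟨ cong (suc k *_) (reorder m n e) ⟩
  suc k * (m + n + e)                              ∎
  where
  open ≤-Reasoning
  cross : 2 * (m * n) ≤ k * (m * m) + (n + e′)
  cross = c*c≤x*y⇒2*c≤x+y (m * n) (k * (m * m)) (n + e′) (begin
    m * n * (m * n)            ≡⟨ regroup m n ⟩
    m * m * (n * n)            ≤⟨ *-monoʳ-≤ (m * m) n²≤ ⟩
    m * m * (k * (n + e′))     ≡⟨ regroup′ m k (n + e′) ⟩
    k * (m * m) * (n + e′)     ∎)
    where
    regroup : ∀ m n → m * n * (m * n) ≡ m * m * (n * n)
    regroup = solve-∀
    regroup′ : ∀ m k b → m * m * (k * b) ≡ k * (m * m) * b
    regroup′ = solve-∀
  expand : ∀ m n → (m + n) * (m + n) ≡ n * n + 2 * (m * n) + m * m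
  expand = solve-∀
  collect : ∀ m n k e′ → k * (n + e′) + (k * (m * m) + (n + e′)) + m * m ≡ suc k * (n + (e′ + m * m))
  collect = solve-∀
  reorder : ∀ m n e → n + (e + m) ≡ m + n + e
  reorder = solve-∀

module _ {d : ℕ} .{{_ : NonZero d}} where

  %-congˡ-+ : ∀ {m n} o → m % d ≡ n % d → (m + o) % d ≡ (n + o) % d
  %-congˡ-+ {m} {n} o eq = begin
    (m + o) % d             ≡⟨ %-distribˡ-+ m o d ⟩
    (m % d + o % d) % d     ≡⟨ cong (λ r → (r + o % d) % d) eq ⟩
    (n % d + o % d) % d     ≡⟨ %-distribˡ-+ n o d ⟨
    (n + o) % d             ∎
    where open ≡-Reasoning

  %-cancelʳ-+ : ∀ m n o → (m + o) % d ≡ (n + o) % d → m % d ≡ n % d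
  %-cancelʳ-+ m n o eq = begin
    m % d               ≡⟨ undo m ⟨
    (m + o + ō) % d     ≡⟨ %-congˡ-+ ō eq ⟩
    (n + o + ō) % d     ≡⟨ undo n ⟩
    n % d               ∎
    where
    open ≡-Reasoning
    -- adding ō := d ∸ o % d after o adds a multiple of d
    ō = d ∸ o % d
    undo : ∀ x → (x + o + ō) % d ≡ x % d
    undo x = trans (cong (_% d) (begin
      x + o + ō                           ≡⟨ cong (λ t → x + t + ō) (m≡m%n+[m/n]*n o d) ⟩
      x + (o % d + o / d * d) + ō         ≡⟨ shuffle x (o % d) (o / d * d) ō ⟩
      x + ((o % d + ō) + o / d * d)       ≡⟨ cong (λ t → x + (t + o / d * d)) (m+[n∸m]≡n (m%n≤n o d)) ⟩
      x + suc (o / d) * d                 ∎)) ([m+kn]%n≡m%n x (suc (o / d)) d)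
      where
      shuffle : ∀ x r q s → x + (r + q) + s ≡ x + ((r + s) + q)
      shuffle = solve-∀

  %-cancelˡ-+ : ∀ m n o → (o + m) % d ≡ (o + n) % d → m % d ≡ n % d
  %-cancelˡ-+ m n o eq = %-cancelʳ-+ m n o (trans (cong (_% d) (+-comm m o)) (trans eq (cong (_% d) (+-comm o n))))

  m+x≡n+y⇒m%d≡n%d : ∀ {m n x y} → m + x ≡ n + y → x % d ≡ y % d → m % d ≡ n % d
  m+x≡n+y⇒m%d≡n%d {m} {n} {x} {y} eq x≡y = %-cancelʳ-+ m n y (begin
    (m + y) % d   ≡⟨ cong (_% d) (+-comm m y) ⟩
    (y + m) % d   ≡⟨ %-congˡ-+ m x≡y ⟨
    (x + m) % d   ≡⟨ cong (_% d) (trans (+-comm x m) eq) ⟩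
    (n + y) % d   ∎)
    where open ≡-Reasoning

  residue-injective : ∀ {x y} → x < d → y < d → x % d ≡ y % d → x ≡ y
  residue-injective x<d y<d eq = trans (sym (m<n⇒m%n≡m x<d)) (trans eq (m<n⇒m%n≡m y<d))

count : {P : Pred A 0ℓ} → Decidable P → List A → ℕ
count P? xs = length (filter P? xs)

module _ {P : Pred A 0ℓ} (P? : Decidable P) where

  count-+-count-∁ : ∀ xs → count P? xs + count (∁? P?) xs ≡ length xs
  count-+-count-∁ [] = refl
  count-+-count-∁ (x ∷ xs) with does (P? x)
  ... | true = cong suc (count-+-count-∁ xs)
  ... | false = trans (+-suc _ _) (cong suc (count-+-count-∁ xs))

  sum-filter-+-sum-filter-∁ : ∀ (f : A → ℕ) xs →
    sum (map f (filter P? xs)) + sum (map f (filter (∁? P?) xs)) ≡ sum (map f xs)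
  sum-filter-+-sum-filter-∁ f [] = refl
  sum-filter-+-sum-filter-∁ f (x ∷ xs) with does (P? x)
  ... | true = trans (+-assoc (f x) _ _) (cong (f x +_) (sum-filter-+-sum-filter-∁ f xs))
  ... | false = trans (+-comm-middle (sum (map f (filter P? xs))) (f x) _) (cong (f x +_) (sum-filter-+-sum-filter-∁ f xs))
    where
    +-comm-middle : ∀ a b c → a + (b + c) ≡ b + (a + c)
    +-comm-middle = solve-∀

  count-mono : ∀ {Q : Pred A 0ℓ} (Q? : Decidable Q) → P ⊆ Q → ∀ xs → count P? xs ≤ count Q? xs
  count-mono Q? P⊆Q xs = Sublist.length-mono-≤ (Sublist.filter⁺ P? Q? (λ { refl → P⊆Q }) (Sublist.⊆-refl {x = xs}))

  count-filter : ∀ {Q : Pred A 0ℓ} (Q? : Decidable Q) xs → count P? (filter Q? xs) ≤ count P? xs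
  count-filter Q? xs = Sublist.length-mono-≤ (Sublist.filter⁺ P? P? (λ { refl p → p }) (Sublist.filter-⊆ Q? xs))

  count-∪ : ∀ {Q : Pred A 0ℓ} (Q? : Decidable Q) xs → count (P? ∪? Q?) xs ≤ count P? xs + count Q? xs
  count-∪ Q? [] = z≤n
  count-∪ Q? (x ∷ xs) with does (P? x) | does (Q? x)
  ... | true  | true  = s≤s (≤-trans (count-∪ Q? xs) (≤-trans (m≤n+m _ 1) (≤-reflexive (sym (+-suc _ _)))))
  ... | true  | false = s≤s (count-∪ Q? xs)
  ... | false | true  = ≤-trans (s≤s (count-∪ Q? xs)) (≤-reflexive (sym (+-suc _ _)))
  ... | false | false = count-∪ Q? xs

count-≡-≤1 : ∀ (_≟_ : DecidableEquality A) v {xs} → Unique xs → count (_≟ v) xs ≤ 1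
count-≡-≤1 _≟_ v {[]} [] = z≤n
count-≡-≤1 _≟_ v {x ∷ xs} (x∉xs ∷ u) with x ≟ v
... | yes refl = s≤s (≤-reflexive (cong length (filter-none (_≟ v) (All.map (_∘ sym) x∉xs))))
... | no _ = count-≡-≤1 _≟_ v u

count-any : ∀ {J} {R : J → Pred A 0ℓ} (R? : ∀ j → Decidable (R j)) js xs →
            count (λ x → any? (λ j → R? j x) js) xs ≤ sum (map (λ j → count (R? j) xs) js)
count-any R? [] xs = ≤-reflexive (cong length (filter-none _ (All.universal (λ _ ()) xs)))
count-any R? (j ∷ js) xs = begin
  count (λ x → any? (λ j → R? j x) (j ∷ js)) xs
    ≤⟨ count-mono _ (R? j ∪? (λ x → any? (λ j → R? j x) js)) toSum xs ⟩
  count (R? j ∪? (λ x → any? (λ j → R? j x) js)) xs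
    ≤⟨ count-∪ (R? j) _ xs ⟩
  count (R? j) xs + count (λ x → any? (λ j → R? j x) js) xs
    ≤⟨ +-monoʳ-≤ (count (R? j) xs) (count-any R? js xs) ⟩
  count (R? j) xs + sum (map (λ j → count (R? j) xs) js) ∎
  where open ≤-Reasoning

sum-map-+ : ∀ (f g : A → ℕ) xs → sum (map (λ x → f x + g x) xs) ≡ sum (map f xs) + sum (map g xs)
sum-map-+ f g [] = refl
sum-map-+ f g (x ∷ xs) = trans (cong (f x + g x +_) (sum-map-+ f g xs)) (interchange (f x) (g x) _ _)
  where
  interchange : ∀ a b c d → a + b + (c + d) ≡ a + c + (b + d)
  interchange = solve-∀

sum-map-zero : ∀ (xs : List A) → sum (map (const 0) xs) ≡ 0
sum-map-zero [] = refl
sum-map-zero (x ∷ xs) = sum-map-zero xs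

sum-map-swap : ∀ (h : A → B → ℕ) xs ys →
  sum (map (λ x → sum (map (h x) ys)) xs) ≡ sum (map (λ y → sum (map (λ x → h x y) xs)) ys)
sum-map-swap h [] ys = sym (sum-map-zero ys)
sum-map-swap h (x ∷ xs) ys = trans (cong (sum (map (h x) ys) +_) (sum-map-swap h xs ys))
  (sym (sum-map-+ (h x) (λ y → sum (map (λ x → h x y) xs)) ys))

sum-map-mono : ∀ {f g : A → ℕ} → (∀ x → f x ≤ g x) → ∀ xs → sum (map f xs) ≤ sum (map g xs)
sum-map-mono f≤g [] = z≤n
sum-map-mono f≤g (x ∷ xs) = +-mono-≤ (f≤g x) (sum-map-mono f≤g xs)

length*≤sum-map : ∀ {f : A → ℕ} {c xs} → All (λ x → c ≤ f x) xs → length xs * c ≤ sum (map f xs)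
length*≤sum-map [] = z≤n
length*≤sum-map (c≤fx ∷ c≤fxs) = +-mono-≤ c≤fx (length*≤sum-map c≤fxs)

sum-map≤length* : ∀ {f : A → ℕ} {c xs} → All (λ x → f x ≤ c) xs → sum (map f xs) ≤ length xs * c
sum-map≤length* [] = z≤n
sum-map≤length* (fx≤c ∷ fxs≤c) = +-mono-≤ fx≤c (sum-map≤length* fxs≤c)

sum-map-update : ∀ {xs : List A} {i} (f g : A → ℕ) → Unique xs → i ∈ xs →
                 (∀ x → x ≢ i → f x ≡ g x) → sum (map f xs) + g i ≡ sum (map g xs) + f i
sum-map-update {xs = x ∷ xs} f g (x∉xs ∷ _) (here refl) f≗g = begin
  f x + sum (map f xs) + g x   ≡⟨ cong (λ s → f x + s + g x) (sum-map-cong xs x∉xs) ⟩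
  f x + sum (map g xs) + g x   ≡⟨ swap-ends (f x) (sum (map g xs)) (g x) ⟩
  g x + sum (map g xs) + f x   ∎
  where
  open ≡-Reasoning
  sum-map-cong : ∀ ys → All (x ≢_) ys → sum (map f ys) ≡ sum (map g ys)
  sum-map-cong [] [] = refl
  sum-map-cong (y ∷ ys) (x≢y ∷ x∉ys) = cong₂ _+_ (f≗g y (x≢y ∘ sym)) (sum-map-cong ys x∉ys)
  swap-ends : ∀ a s b → a + s + b ≡ b + s + a
  swap-ends = solve-∀
sum-map-update {xs = x ∷ xs} {i} f g (x∉xs ∷ u) (there i∈xs) f≗g = begin
  f x + sum (map f xs) + g i   ≡⟨ +-assoc (f x) _ (g i) ⟩
  f x + (sum (map f xs) + g i) ≡⟨ cong₂ _+_ (f≗g x x≢i) (sum-map-update f g u i∈xs f≗g) ⟩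
  g x + (sum (map g xs) + f i) ≡⟨ +-assoc (g x) _ (f i) ⟨
  g x + sum (map g xs) + f i   ∎
  where
  open ≡-Reasoning
  x≢i : x ≢ i
  x≢i = All.lookup x∉xs i∈xs

unique⇒lookup-injective : ∀ {xs : List A} → Unique xs → ∀ {i j} → List.lookup xs i ≡ List.lookup xs j → i ≡ j
unique⇒lookup-injective (_ ∷ _) {zero} {zero} _ = refl
unique⇒lookup-injective (x∉xs ∷ _) {zero} {suc j} eq = contradiction eq (All.lookup x∉xs (∈-lookup j))
unique⇒lookup-injective (x∉xs ∷ _) {suc i} {zero} eq = contradiction (sym eq) (All.lookup x∉xs (∈-lookup i))
unique⇒lookup-injective (_ ∷ u) {suc i} {suc j} eq = cong suc (unique⇒lookup-injective u eq)

length≤-injectiveOn : ∀ {P : Pred A 0ℓ} {N xs} (f : A → Fin N) →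
  (∀ {x y} → P x → P y → f x ≡ f y → x ≡ y) → Unique xs → All P xs → length xs ≤ N
length≤-injectiveOn f f-inj u all = injective⇒≤ λ {i} {j} eq →
  unique⇒lookup-injective u (f-inj (All.lookup all (∈-lookup i)) (All.lookup all (∈-lookup j)) eq)

module _ {R : REL A B 0ℓ} (R? : Binary.Decidable R) where

  count-cartesianProduct : ∀ as bs →
    count (uncurry R?) (cartesianProduct as bs) ≡ sum (map (λ a → count (R? a) bs) as)
  count-cartesianProduct [] bs = refl
  count-cartesianProduct (a ∷ as) bs = begin
    count (uncurry R?) (map (a ,_) bs ++ cartesianProduct as bs)
      ≡⟨ cong length (filter-++ (uncurry R?) (map (a ,_) bs) _) ⟩
    length (filter (uncurry R?) (map (a ,_) bs) ++ filter (uncurry R?) (cartesianProduct as bs))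
      ≡⟨ length-++ (filter (uncurry R?) (map (a ,_) bs)) ⟩
    count (uncurry R?) (map (a ,_) bs) + count (uncurry R?) (cartesianProduct as bs)
      ≡⟨ cong₂ _+_ (row bs) (count-cartesianProduct as bs) ⟩
    count (R? a) bs + sum (map (λ a → count (R? a) bs) as) ∎
    where
    open ≡-Reasoning
    row : ∀ bs → count (uncurry R?) (map (a ,_) bs) ≡ count (R? a) bs
    row [] = refl
    row (b ∷ bs) with does (R? a b)
    ... | true = cong suc (row bs)
    ... | false = row bs

  sum-count≤ : ∀ {as bs N} (k : A → B → Fin N) → Unique as → Unique bs →
    (∀ {a b a′ b′} → R a b → R a′ b′ → k a b ≡ k a′ b′ → a ≡ a′ × b ≡ b′) →
    sum (map (λ a → count (R? a) bs) as) ≤ N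
  sum-count≤ {as} {bs} k uas ubs k-inj = subst (_≤ _) (count-cartesianProduct as bs)
    (length≤-injectiveOn (uncurry k) (λ { r r′ eq → uncurry (cong₂ _,_) (k-inj r r′ eq) })
      (Unique.filter⁺ (uncurry R?) (Unique.cartesianProduct⁺ uas ubs))
      (all-filter (uncurry R?) (cartesianProduct as bs)))

sum-count-any≤ : ∀ {J} {R : J → REL A B 0ℓ} (R? : ∀ j → Binary.Decidable (R j)) js as bs {c} →
  (∀ j → sum (map (λ a → count (R? j a) bs) as) ≤ c) →
  sum (map (λ a → count (λ b → any? (λ j → R? j a b) js) bs) as) ≤ length js * c
sum-count-any≤ R? js as bs {c} bound = begin
  sum (map (λ a → count (λ b → any? (λ j → R? j a b) js) bs) as)
    ≤⟨ sum-map-mono (λ a → count-any (λ j → R? j a) js bs) as ⟩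
  sum (map (λ a → sum (map (λ j → count (R? j a) bs) js)) as)
    ≡⟨ sum-map-swap (λ a j → count (R? j a) bs) as js ⟩
  sum (map (λ j → sum (map (λ a → count (R? j a) bs) as)) js)
    ≤⟨ sum-map≤length* (All.universal bound js) ⟩
  length js * c ∎
  where open ≤-Reasoning

-- Points and cycles in F_p^n

lookup-ext : ∀ {n} {u v : Vec A n} → (∀ k → lookup u k ≡ lookup v k) → u ≡ v
lookup-ext {u = u} {v} eq = trans (sym (tabulate∘lookup u)) (trans (tabulate-cong eq) (tabulate∘lookup v))

encode : ∀ {p n} → Point p n → Fin (p ^ n)
encode u = funToFin (lookup u)

encode-injective : ∀ {p n} {u v : Point p n} → encode u ≡ encode v → u ≡ v
encode-injective {u = u} {v} eq = lookup-ext λ k → begin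
  lookup u k                ≡⟨ finToFun-funToFin (lookup u) k ⟨
  finToFun (encode u) k     ≡⟨ cong (λ c → finToFun c k) eq ⟩
  finToFun (encode v) k     ≡⟨ finToFun-funToFin (lookup v) k ⟩
  lookup v k                ∎
  where open ≡-Reasoning

coord : ∀ {p n} → Point p n → Fin n → ℕ
coord u k = toℕ (lookup u k)

module _ {p n : ℕ} .{{_ : NonZero p}} where

  infixl 6 _⊕_
  _⊕_ : Point p n → Point p n → Point p n
  _⊕_ = zipWith (λ a b → (toℕ a + toℕ b) mod p)

  coord-⊕ : ∀ u v k → coord (u ⊕ v) k ≡ (coord u k + coord v k) % p
  coord-⊕ u v k = trans (cong toℕ (lookup-zipWith _ k u v)) (toℕ-fromℕ< _)

  ⊕-≡⇒coord-≡ : ∀ {u v u′ v′} → u ⊕ v ≡ u′ ⊕ v′ → ∀ k →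
                 (coord u k + coord v k) % p ≡ (coord u′ k + coord v′ k) % p
  ⊕-≡⇒coord-≡ {u} {v} {u′} {v′} eq k =
    trans (sym (coord-⊕ u v k)) (trans (cong (λ w → coord w k) eq) (coord-⊕ u′ v′ k))

  ⊕-cancelˡ : ∀ u {v v′} → u ⊕ v ≡ u ⊕ v′ → v ≡ v′
  ⊕-cancelˡ u {v} {v′} eq = lookup-ext λ k → toℕ-injective
    (residue-injective (toℕ<n (lookup v k)) (toℕ<n (lookup v′ k))
      (%-cancelˡ-+ (coord v k) (coord v′ k) (coord u k) (⊕-≡⇒coord-≡ eq k)))

  columnSum : Tuple p n → Fin n → ℕ
  columnSum x k = sum (map (λ i → coord (x i) k) (allFin p))

  _[_]≔_ : Tuple p n → Fin p → Point p n → Tuple p n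
  x [ i ]≔ v = updateAt x i (const v)

  ≔-updates : ∀ x i v → (x [ i ]≔ v) i ≡ v
  ≔-updates x i v = updateAt-updates i x

  ≔-minimal : ∀ x i v t → t ≢ i → (x [ i ]≔ v) t ≡ x t
  ≔-minimal x i v t = updateAt-minimal t i x

  InProd-≔ : ∀ {X : Fin p → Pred (Point p n) 0ℓ} {x i v} → InProd X x → X i v → InProd X (x [ i ]≔ v)
  InProd-≔ {X} {x} {i} {v} x∈X v∈X t with t Fin.≟ i
  ... | yes refl = subst (X t) (sym (≔-updates x t v)) v∈X
  ... | no t≢i = subst (X t) (sym (≔-minimal x i v t t≢i)) (x∈X t)

  columnSum-≔ : ∀ x i v k → columnSum (x [ i ]≔ v) k + coord (x i) k ≡ columnSum x k + coord v k
  columnSum-≔ x i v k = trans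
    (sum-map-update (λ t → coord ((x [ i ]≔ v) t) k) (λ t → coord (x t) k)
      (Unique.allFin⁺ p) (∈-allFin i) (λ t t≢i → cong (λ w → coord w k) (≔-minimal x i v t t≢i)))
    (cong (λ w → columnSum x k + coord w k) (≔-updates x i v))

  IsCycle-≔₂ : ∀ {x} i i′ {v v′} → IsCycle p n x → i ≢ i′ → x i ⊕ x i′ ≡ v ⊕ v′ →
               IsCycle p n ((x [ i ]≔ v) [ i′ ]≔ v′)
  IsCycle-≔₂ {x} i i′ {v} {v′} x-cycle i≢i′ balanced k =
    trans (m+x≡n+y⇒m%d≡n%d columnSums (⊕-≡⇒coord-≡ balanced k)) (x-cycle k)
    where
    open ≡-Reasoning
    y = x [ i ]≔ v
    columnSums : columnSum (y [ i′ ]≔ v′) k + (coord (x i) k + coord (x i′) k)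
               ≡ columnSum x k + (coord v k + coord v′ k)
    columnSums = begin
      columnSum (y [ i′ ]≔ v′) k + (coord (x i) k + coord (x i′) k)
        ≡⟨ cong (λ w → columnSum (y [ i′ ]≔ v′) k + (coord (x i) k + coord w k))
                (≔-minimal x i v i′ (i≢i′ ∘ sym)) ⟨
      columnSum (y [ i′ ]≔ v′) k + (coord (x i) k + coord (y i′) k)
        ≡⟨ shuffle (columnSum (y [ i′ ]≔ v′) k) (coord (x i) k) (coord (y i′) k) ⟩
      columnSum (y [ i′ ]≔ v′) k + coord (y i′) k + coord (x i) k
        ≡⟨ cong (_+ coord (x i) k) (columnSum-≔ y i′ v′ k) ⟩
      columnSum y k + coord v′ k + coord (x i) k
        ≡⟨ shuffle′ (columnSum y k) (coord v′ k) (coord (x i) k) ⟩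
      columnSum y k + coord (x i) k + coord v′ k
        ≡⟨ cong (_+ coord v′ k) (columnSum-≔ x i v k) ⟩
      columnSum x k + coord v k + coord v′ k
        ≡⟨ +-assoc (columnSum x k) (coord v k) (coord v′ k) ⟩
      columnSum x k + (coord v k + coord v′ k) ∎
      where
      shuffle : ∀ s a b → s + (a + b) ≡ s + b + a
      shuffle = solve-∀
      shuffle′ : ∀ s a b → s + a + b ≡ s + b + a
      shuffle′ = solve-∀

-- Turán's bound for independent sets

module Turán {A : Set} (_≟_ : DecidableEquality A)
             {E : Rel A 0ℓ} (E? : Binary.Decidable E) (E-sym : Symmetric E) where

  degree : List A → A → ℕ
  degree V v = count (E? v) V

  degreeSum : List A → ℕ
  degreeSum V = sum (map (degree V) V)

  Independent : List A → Set
  Independent I = ∀ {a b} → a ∈ I → b ∈ I → a ≢ b → ¬ E a b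

  record IndependentSet (V : List A) : Set where
    field
      members     : List A
      unique      : Unique members
      ⊆V          : ∀ {x} → x ∈ members → x ∈ V
      independent : Independent members
      large       : length V * length V ≤ length members * (length V + degreeSum V)

  closedNbhd? : ∀ v → Decidable ((_≡ v) ∪ E v)
  closedNbhd? v = (_≟ v) ∪? E? v

  closedNbhd-size : ∀ {V} → Unique V → ∀ v → count (closedNbhd? v) V ≤ suc (degree V v)
  closedNbhd-size {V} uV v =
    ≤-trans (count-∪ (_≟ v) (E? v) V) (+-monoˡ-≤ (degree V v) (count-≡-≤1 _≟_ v uV))

  -- Every vertex of the closed neighbourhood of v has degree ≥ degree V v ≥ m − 1.
  degreeSum-remove : ∀ {V} → Unique V → ∀ v → (∀ {w} → w ∈ V → degree V v ≤ degree V w) →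
    let m = count (closedNbhd? v) V in
    degreeSum (filter (∁? (closedNbhd? v)) V) + m * m ≤ degreeSum V + m
  degreeSum-remove {V} uV v v-min = begin
    degreeSum V′ + m * m
      ≤⟨ +-mono-≤ shrink square ⟩
    sum (map (degree V) V′) + (m + sum (map (degree V) R))
      ≡⟨ rearrange (sum (map (degree V) V′)) m _ ⟩
    sum (map (degree V) R) + sum (map (degree V) V′) + m
      ≡⟨ cong (_+ m) (sum-filter-+-sum-filter-∁ (closedNbhd? v) (degree V) V) ⟩
    degreeSum V + m ∎
    where
    open ≤-Reasoning
    V′ = filter (∁? (closedNbhd? v)) V
    R = filter (closedNbhd? v) V
    m = length R
    d = degree V v
    shrink : degreeSum V′ ≤ sum (map (degree V) V′)
    shrink = sum-map-mono (λ w → count-filter (E? w) (∁? (closedNbhd? v)) V) V′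
    square : m * m ≤ m + sum (map (degree V) R)
    square = begin
      m * m              ≤⟨ *-monoʳ-≤ m (closedNbhd-size uV v) ⟩
      m * suc d          ≡⟨ *-suc m d ⟩
      m + m * d          ≤⟨ +-monoʳ-≤ m (length*≤sum-map (All.tabulate (v-min ∘ proj₁ ∘ ∈-filter⁻ (closedNbhd? v)))) ⟩
      m + sum (map (degree V) R) ∎
    rearrange : ∀ a m b → a + (m + b) ≡ b + a + m
    rearrange = solve-∀

  turán-bounded : ∀ k V → Unique V → length V ≤ k → IndependentSet V
  turán-bounded _ [] _ _ = record
    { members = [] ; unique = [] ; ⊆V = λ () ; independent = λ () ; large = z≤n }
  turán-bounded zero (_ ∷ _) _ ()
  turán-bounded (suc k) V@(x ∷ xs) uV |V|≤ = record
    { members = v ∷ I.members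
    ; unique = All.tabulate (λ w∈I w≡v → far (I.⊆V w∈I) (inj₁ (sym w≡v))) ∷ I.unique
    ; ⊆V = λ { (here refl) → v∈V ; (there w∈I) → proj₁ (∈-filter⁻ (∁? (closedNbhd? v)) (I.⊆V w∈I)) }
    ; independent = independent
    ; large = subst (λ l → l * l ≤ suc (length I.members) * (l + degreeSum V)) split
                (turán-step m (length V′) (length I.members) (degreeSum V) (degreeSum V′)
                  I.large (degreeSum-remove uV v v-min))
    }
    where
    v = argmin (degree V) x xs
    v∈V : v ∈ V
    v∈V = [ here , there ]′ (argmin-sel (degree V) x xs)
    v-min : ∀ {w} → w ∈ V → degree V v ≤ degree V w
    v-min = All.lookup (f[argmin]≤f[⊤] {f = degree V} x xs ∷ f[argmin]≤f[xs] x xs)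
    V′ = filter (∁? (closedNbhd? v)) V
    m = count (closedNbhd? v) V
    split : m + length V′ ≡ length V
    split = count-+-count-∁ (closedNbhd? v) V
    |V′|≤k : length V′ ≤ k
    |V′|≤k = ≤-pred (≤-trans (+-monoˡ-≤ (length V′) (filter-some (closedNbhd? v) (lose v∈V (inj₁ refl))))
                             (≤-trans (≤-reflexive split) |V|≤))
    module I = IndependentSet (turán-bounded k V′ (Unique.filter⁺ (∁? (closedNbhd? v)) uV) |V′|≤k)
    far : ∀ {w} → w ∈ V′ → ¬ (w ≡ v ⊎ E v w)
    far = proj₂ ∘ ∈-filter⁻ (∁? (closedNbhd? v))
    independent : Independent (v ∷ I.members)
    independent (here refl) (here refl) v≢v = contradiction refl v≢v
    independent (here refl) (there b∈I) _ = far (I.⊆V b∈I) ∘ inj₂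
    independent (there a∈I) (here refl) _ = far (I.⊆V a∈I) ∘ inj₂ ∘ E-sym
    independent (there a∈I) (there b∈I) = I.independent a∈I b∈I

  turán : ∀ V → Unique V → IndependentSet V
  turán V uV = turán-bounded (length V) V uV ≤-refl

-- The conflict graph of a family of disjoint cycles

module CycleFamily (q n : ℕ) (X : Fin (2 + q) → Pred (Point (2 + q) n) 0ℓ)
  (first-two-equal : ∀ x → InProd X x → IsCycle (2 + q) n x → x zero ≡ x (suc zero))
  (L : ℕ) (M : Fin L → Tuple (2 + q) n)
  (M-cycle : ∀ a → InProd X (M a) × IsCycle (2 + q) n (M a))
  (M-disjoint : ∀ a b → a ≢ b → Disjoint (M a) (M b)) where

  p : ℕ
  p = 2 + q

  -- The paper's indices j ∈ {3, …, p}, counted from 0.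
  index : Fin q → Fin p
  index j = suc (suc j)

  M-entry-injective : ∀ i {a b} → M a i ≡ M b i → a ≡ b
  M-entry-injective i {a} {b} eq with a Fin.≟ b
  ... | yes a≡b = a≡b
  ... | no a≢b = contradiction eq (M-disjoint a b a≢b i i)

  M-first-two-equal : ∀ a → M a zero ≡ M a (suc zero)
  M-first-two-equal a = first-two-equal (M a) (proj₁ (M-cycle a)) (proj₂ (M-cycle a))

  sumPoint : Fin p → Fin L → Fin L → Point p n
  sumPoint j a b = M a zero ⊕ M b j

  SharedSum : Fin p → Fin L → Fin L → Set
  SharedSum j a b = ∃₂ λ d e → d ≢ a × sumPoint j d e ≡ sumPoint j a b

  sharedSum? : ∀ j → Binary.Decidable (SharedSum j)
  sharedSum? j a b = Fin.any? λ d → Fin.any? λ e →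
    ¬? (d Fin.≟ a) ×-dec ≡-dec Fin._≟_ (sumPoint j d e) (sumPoint j a b)

  sharedSum⇒¬extendable : ∀ j {a b} → SharedSum (index j) a b →
    ¬ Extendable p n X (index j) (M a zero) (M b (index j))
  sharedSum⇒¬extendable j {a} {b} (d , e , d≢a , same) (u , u∈X , u-cycle , u₀≡ , uⱼ≡) =
    M-disjoint d a d≢a zero zero (sym Ma₀≡Md₀)
    where
    open ≡-Reasoning
    one j′ : Fin p
    one = suc zero
    j′ = index j
    u′ = u [ one ]≔ M d one
    w = u′ [ j′ ]≔ M e j′
    balanced : u one ⊕ u j′ ≡ M d one ⊕ M e j′
    balanced = begin
      u one ⊕ u j′         ≡⟨ cong₂ _⊕_ (trans (sym (first-two-equal u u∈X u-cycle)) (u₀≡ zero refl)) uⱼ≡ ⟩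
      M a zero ⊕ M b j′    ≡⟨ same ⟨
      M d zero ⊕ M e j′    ≡⟨ cong (_⊕ M e j′) (M-first-two-equal d) ⟩
      M d one ⊕ M e j′     ∎
    w∈X : InProd X w
    w∈X = InProd-≔ {X = X} (InProd-≔ {X = X} u∈X (proj₁ (M-cycle d) one)) (proj₁ (M-cycle e) j′)
    w-cycle : IsCycle p n w
    w-cycle = IsCycle-≔₂ {x = u} one j′ u-cycle (λ ()) balanced
    Ma₀≡Md₀ : M a zero ≡ M d zero
    Ma₀≡Md₀ = begin
      M a zero     ≡⟨ u₀≡ zero refl ⟨
      u zero       ≡⟨ ≔-minimal u one (M d one) zero (λ ()) ⟨
      u′ zero      ≡⟨ ≔-minimal u′ j′ (M e j′) zero (λ ()) ⟨
      w zero       ≡⟨ first-two-equal w w∈X w-cycle ⟩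
      w one        ≡⟨ ≔-minimal u′ j′ (M e j′) one (λ ()) ⟩
      u′ one       ≡⟨ ≔-updates u one (M d one) ⟩
      M d one      ≡⟨ M-first-two-equal d ⟨
      M d zero     ∎

  sumPoint-injective : ∀ {j a b a′ b′} → ¬ SharedSum j a b →
    sumPoint j a b ≡ sumPoint j a′ b′ → a ≡ a′ × b ≡ b′
  sumPoint-injective {j} {a} {b} {a′} {b′} unshared eq with a′ Fin.≟ a
  ... | no a′≢a = contradiction (a′ , b′ , a′≢a , sym eq) unshared
  ... | yes refl = refl , M-entry-injective j (⊕-cancelˡ (M a zero) eq)

  vertices : List (Fin L)
  vertices = allFin L

  Unshared : Fin q → Rel (Fin L) 0ℓ
  Unshared j a b = ¬ SharedSum (index j) a b

  unshared? : ∀ j → Binary.Decidable (Unshared j)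
  unshared? j a b = ¬? (sharedSum? (index j) a b)

  unshared-count≤ : ∀ j → sum (map (λ a → count (unshared? j a) vertices) vertices) ≤ p ^ n
  unshared-count≤ j = sum-count≤ (unshared? j) (λ a b → encode (sumPoint (index j) a b))
    (Unique.allFin⁺ L) (Unique.allFin⁺ L) (λ unshared _ eq → sumPoint-injective unshared (encode-injective eq))

  unshared-countᵀ≤ : ∀ j → sum (map (λ a → count (λ b → unshared? j b a) vertices) vertices) ≤ p ^ n
  unshared-countᵀ≤ j = sum-count≤ (λ a b → unshared? j b a) (λ a b → encode (sumPoint (index j) b a))
    (Unique.allFin⁺ L) (Unique.allFin⁺ L) (λ unshared _ eq → swap (sumPoint-injective unshared (encode-injective eq)))

  Bad : Rel (Fin L) 0ℓ
  Bad a b = Any (λ j → Unshared j a b) (allFin q)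

  bad? : Binary.Decidable Bad
  bad? a b = any? (λ j → unshared? j a b) (allFin q)

  Conflict : Rel (Fin L) 0ℓ
  Conflict a b = Bad a b ⊎ Bad b a

  conflict? : Binary.Decidable Conflict
  conflict? a b = bad? a b ⊎-dec bad? b a

  open Turán Fin._≟_ conflict? Sum.swap public

  degreeSum≤ : degreeSum vertices ≤ q * p ^ n + q * p ^ n
  degreeSum≤ = begin
    degreeSum vertices
      ≤⟨ sum-map-mono (λ a → count-∪ (bad? a) (λ b → bad? b a) vertices) vertices ⟩
    sum (map (λ a → count (bad? a) vertices + count (λ b → bad? b a) vertices) vertices)
      ≡⟨ sum-map-+ _ _ vertices ⟩
    sum (map (λ a → count (bad? a) vertices) vertices) + sum (map (λ a → count (λ b → bad? b a) vertices) vertices)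
      ≤⟨ +-mono-≤ (sum-count-any≤ unshared? (allFin q) vertices vertices unshared-count≤)
                  (sum-count-any≤ (λ j a b → unshared? j b a) (allFin q) vertices vertices unshared-countᵀ≤) ⟩
    length (allFin q) * p ^ n + length (allFin q) * p ^ n
      ≡⟨ cong (λ l → l * p ^ n + l * p ^ n) (length-tabulate {n = q} id) ⟩
    q * p ^ n + q * p ^ n ∎
    where open ≤-Reasoning

  L≤p^n : L ≤ p ^ n
  L≤p^n = injective⇒≤ {f = λ a → encode (M a zero)} (M-entry-injective zero ∘ encode-injective)

  order+degreeSum≤ : L + degreeSum vertices ≤ 2 * p ^ suc n
  order+degreeSum≤ = begin
    L + degreeSum vertices                     ≤⟨ +-mono-≤ L≤p^n degreeSum≤ ⟩
    p ^ n + (q * p ^ n + q * p ^ n)            ≤⟨ m≤m+n _ (3 * p ^ n) ⟩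
    p ^ n + (q * p ^ n + q * p ^ n) + 3 * p ^ n ≡⟨ collect q (p ^ n) ⟩
    2 * (p * p ^ n)                            ∎
    where
    open ≤-Reasoning
    collect : ∀ q N → N + (q * N + q * N) + 3 * N ≡ 2 * ((2 + q) * N)
    collect = solve-∀

lemma3p2 : (p n : ℕ) → .{{_ : NonZero p}} → Prime p → 5 ≤ p → 1 ≤ n →
    (X : Fin p → Pred (Point p n) 0ℓ) →
    ((x : Tuple p n) → InProd X x → IsCycle p n x →
      (i i' : Fin p) → toℕ i ≡ 0 → toℕ i' ≡ 1 → x i ≡ x i') →
    (L : ℕ) → 1 ≤ L → (M : Fin L → Tuple p n) →
    ((a : Fin L) → InProd X (M a) × IsCycle p n (M a)) →
    ((a b : Fin L) → a ≢ b → Disjoint (M a) (M b)) →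
    Σ (List (Fin L)) λ M' → Unique M' × (L * L ≤ 2 * p ^ (suc n) * length M') ×
      ((a b : Fin L) → a ∈ M' → b ∈ M' → a ≢ b →
        (j : Fin p) → 2 ≤ toℕ j → (i : Fin p) → toℕ i ≡ 0 →
        ¬ Extendable p n X j (M a i) (M b j))
lemma3p2 (suc (suc q)) n _ _ _ X H L _ M M-cycle M-disjoint = members , unique , size , unextendable
  where
  open CycleFamily q n X (λ x x∈X x-cycle → H x x∈X x-cycle zero (suc zero) refl refl) L M M-cycle M-disjoint
  open IndependentSet (turán vertices (Unique.allFin⁺ L))
  size : L * L ≤ 2 * p ^ suc n * length members
  size = begin
    L * L                                      ≤⟨ subst (λ l → l * l ≤ length members * (l + degreeSum vertices))
                                                        (length-tabulate {n = L} id) large ⟩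
    length members * (L + degreeSum vertices)  ≤⟨ *-monoʳ-≤ (length members) order+degreeSum≤ ⟩
    length members * (2 * p ^ suc n)           ≡⟨ *-comm (length members) _ ⟩
    2 * p ^ suc n * length members             ∎
    where open ≤-Reasoning
  unextendable : ∀ a b → a ∈ members → b ∈ members → a ≢ b → ∀ j → 2 ≤ toℕ j → ∀ i → toℕ i ≡ 0 →
                 ¬ Extendable p n X j (M a i) (M b j)
  unextendable a b a∈I b∈I a≢b (suc (suc j)) _ zero refl = sharedSum⇒¬extendable j
    (decidable-stable (sharedSum? _ a b) λ unshared → independent a∈I b∈I a≢b (inj₁ (lose (∈-allFin j) unshared)))
  unextendable _ _ _ _ _ (suc zero) (s≤s ()) _ _
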